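{- (Disentanglement) If $\vdash \Gamma_1 \mid \cdots \mid \Gamma_n$ is derivable in the type-only HCP sequent system, then each of $\vdash\Gamma_1$, …, $\vdash\Gamma_n$ is derivable in classical linear logic (CLL).
   Context: Formulas: $A,B ::= A\otimes B \mid A ⅋ B \mid A\oplus B \mid A\&B \mid 1\mid\bot\mid ?A\mid !A$, with involutive duality $(A\otimes B)^\perp = A^\perp ⅋ B^\perp$, $(A\oplus B)^\perp = A^\perp \& B^\perp$, $1^\perp = \bot$, $(?A)^\perp = !A^\perp$ (and symmetrically). Environments $\Gamma,\Delta$ are finite unordered multisets of formulas; $?\Gamma$ denotes one whose formulas all have the form $?B$. CLL is Girard's one-sided sequent calculus (without Mix): $\vdash A^\perp, A$; Cut: from $\vdash\Gamma,A$ and $\vdash\Delta,A^\perp$ infer $\vdash\Gamma,\Delta$; $\otimes$: from $\vdash\Gamma,A$ and $\vdash\Delta,B$ infer $\vdash\Gamma,\Delta,A\otimes B$; ⅋: from $\vdash \Gamma,A,B$ infer $\vdash\Gamma,A⅋B$; $\vdash 1$; $\bot$: from $\vdash\Gamma$ infer $\vdash\Gamma,\bot$; $\oplus_i$: from $\vdash\Gamma,A_i$ infer $\vdash\Gamma,A_1\oplus A_2$; $\&$: from $\vdash\Gamma,A$ and $\vdash\Gamma,B$ infer $\vdash\Gamma,A\&B$; $!$: from $\vdash ?\Gamma,A$ infer $\vdash ?\Gamma,!A$; $?$: from $\vdash\Gamma,A$ infer $\vdash\Gamma,?A$; weakening: from $\vdash\Gamma$ infer $\vdash\Gamma,?A$;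 contraction: from $\vdash\Gamma,?A,?A$ infer $\vdash\Gamma,?A$. A hyperenvironment $\mathcal{G}=\Gamma_1\mid\cdots\mid\Gamma_n$ is an unordered collection of environments ($\varnothing$ the empty one). The type-only HCP system derives $\vdash \mathcal{G}$ by: (Ax) $\vdash A^\perp,A$; (H-Cut) from $\vdash \mathcal{G}\mid\Gamma,A\mid\Delta,A^\perp$ infer $\vdash\mathcal{G}\mid\Gamma,\Delta$; (H-Mix) from $\vdash\mathcal{G}$ and $\vdash\mathcal{H}$ infer $\vdash\mathcal{G}\mid\mathcal{H}$; (H-Mix$_0$) $\vdash\varnothing$; ($\otimes$) from $\vdash\mathcal{G}\mid\Gamma,A\mid\Delta,B$ infer $\vdash\mathcal{G}\mid\Gamma,\Delta,A\otimes B$; ($1$) from $\vdash\mathcal{G}$ infer $\vdash\mathcal{G}\mid 1$; (⅋) from $\vdash\mathcal{G}\mid\Gamma,A,B$ infer $\vdash\mathcal{G}\mid\Gamma,A⅋B$; ($\bot$) from $\vdash\mathcal{G}\mid\Gamma$ infer $\vdash\mathcal{G}\mid\Gamma,\bot$; ($\oplus_i$) from $\vdash\mathcal{G}\mid\Gamma,A_i$ infer $\vdash\mathcal{G}\mid\Gamma,A_1\oplus A_2$; ($\&$) from $\vdash\Gamma,A$ and $\vdash\Gamma,B$ infer $\vdash\Gamma,A\&B$; ($!$) from $\vdash ?\Gamma,A$ infer $\vdash ?\Gamma,!A$; ($?$) from $\vdash\mathcal{G}\mid\Gamma,A$ infer $\vdash\mathcal{G}\mid\Gamma,?A$; (W)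 from $\vdash\mathcal{G}\mid\Gamma$ infer $\vdash\mathcal{G}\mid\Gamma,?A$; (C) from $\vdash\mathcal{G}\mid\Gamma,?A,?A$ infer $\vdash\mathcal{G}\mid\Gamma,?A$. -}

module Defs where

open import Data.Nat using (ℕ)
open import Data.List using (List; []; _∷_; _++_; map)
open import Data.List.Relation.Unary.All using (All)
open import Data.List.Relation.Binary.Permutation.Propositional using (_↭_)

-- Formulas of CLL (propositional atoms X and their duals X⊥ are included,
-- as is standard; the axiom ⊢ A⊥, A is stated for all formulas).
data Formula : Set where
  pos neg  : ℕ → Formula
  _⊗_ _⅋_ _⊕_ _&_ : Formula → Formula → Formula
  𝟏 ⊥′ : Formula
  `?_ `!_ : Formula → Formula

infixr 6 _⊗_ _⅋_
infixr 5 _⊕_ _&_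

_^⊥ : Formula → Formula
pos x ^⊥ = neg x
neg x ^⊥ = pos x
(A ⊗ B) ^⊥ = (A ^⊥) ⅋ (B ^⊥)
(A ⅋ B) ^⊥ = (A ^⊥) ⊗ (B ^⊥)
(A ⊕ B) ^⊥ = (A ^⊥) & (B ^⊥)
(A & B) ^⊥ = (A ^⊥) ⊕ (B ^⊥)
𝟏 ^⊥ = ⊥′
⊥′ ^⊥ = 𝟏
(`? A) ^⊥ = `! (A ^⊥)
(`! A) ^⊥ = `? (A ^⊥)

-- Environments: finite multisets, represented as lists up to permutation
-- (an explicit exchange rule).
Env : Set
Env = List Formula

data IsWhyNot : Formula → Set where
  why : ∀ B → IsWhyNot (`? B)

WhyNotEnv : Env → Set
WhyNotEnv Γ = All IsWhyNot Γ

-- Classical linear logic (one-sided, without Mix)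
data ⊢CLL : Env → Set where
  exch : ∀ {Γ Δ} → Γ ↭ Δ → ⊢CLL Γ → ⊢CLL Δ
  ax   : ∀ A → ⊢CLL (A ^⊥ ∷ A ∷ [])
  cut  : ∀ {Γ Δ} A → ⊢CLL (A ∷ Γ) → ⊢CLL (A ^⊥ ∷ Δ) → ⊢CLL (Γ ++ Δ)
  ⊗R   : ∀ {Γ Δ A B} → ⊢CLL (A ∷ Γ) → ⊢CLL (B ∷ Δ) → ⊢CLL ((A ⊗ B) ∷ Γ ++ Δ)
  ⅋R   : ∀ {Γ A B} → ⊢CLL (A ∷ B ∷ Γ) → ⊢CLL ((A ⅋ B) ∷ Γ)
  𝟏R   : ⊢CLL (𝟏 ∷ [])
  ⊥R   : ∀ {Γ} → ⊢CLL Γ → ⊢CLL (⊥′ ∷ Γ)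
  ⊕₁   : ∀ {Γ A B} → ⊢CLL (A ∷ Γ) → ⊢CLL ((A ⊕ B) ∷ Γ)
  ⊕₂   : ∀ {Γ A B} → ⊢CLL (B ∷ Γ) → ⊢CLL ((A ⊕ B) ∷ Γ)
  &R   : ∀ {Γ A B} → ⊢CLL (A ∷ Γ) → ⊢CLL (B ∷ Γ) → ⊢CLL ((A & B) ∷ Γ)
  !R   : ∀ {Γ A} → WhyNotEnv Γ → ⊢CLL (A ∷ Γ) → ⊢CLL ((`! A) ∷ Γ)
  ?R   : ∀ {Γ A} → ⊢CLL (A ∷ Γ) → ⊢CLL ((`? A) ∷ Γ)
  weak : ∀ {Γ A} → ⊢CLL Γ → ⊢CLL ((`? A) ∷ Γ)
  contr : ∀ {Γ A} → ⊢CLL ((`? A) ∷ (`? A) ∷ Γ) → ⊢CLL ((`? A) ∷ Γ)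

-- Hyperenvironments: finite multisets of environments, represented as
-- lists of environments up to permutation (outer exchange) and up to
-- permutation inside each environment (inner exchange).
HEnv : Set
HEnv = List Env

data ⊢HCP : HEnv → Set where
  hexch : ∀ {G H} → G ↭ H → ⊢HCP G → ⊢HCP H
  exch  : ∀ {G Γ Δ} → Γ ↭ Δ → ⊢HCP (Γ ∷ G) → ⊢HCP (Δ ∷ G)
  ax    : ∀ A → ⊢HCP ((A ^⊥ ∷ A ∷ []) ∷ [])
  hcut  : ∀ {G Γ Δ} A → ⊢HCP ((A ∷ Γ) ∷ (A ^⊥ ∷ Δ) ∷ G) → ⊢HCP ((Γ ++ Δ) ∷ G)
  hmix  : ∀ {G H} → ⊢HCP G → ⊢HCP H → ⊢HCP (G ++ H)
  hmix₀ : ⊢HCP []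
  ⊗R    : ∀ {G Γ Δ A B} → ⊢HCP ((A ∷ Γ) ∷ (B ∷ Δ) ∷ G) → ⊢HCP (((A ⊗ B) ∷ Γ ++ Δ) ∷ G)
  𝟏R    : ∀ {G} → ⊢HCP G → ⊢HCP ((𝟏 ∷ []) ∷ G)
  ⅋R    : ∀ {G Γ A B} → ⊢HCP ((A ∷ B ∷ Γ) ∷ G) → ⊢HCP (((A ⅋ B) ∷ Γ) ∷ G)
  ⊥R    : ∀ {G Γ} → ⊢HCP (Γ ∷ G) → ⊢HCP ((⊥′ ∷ Γ) ∷ G)
  ⊕₁    : ∀ {G Γ A B} → ⊢HCP ((A ∷ Γ) ∷ G) → ⊢HCP (((A ⊕ B) ∷ Γ) ∷ G)
  ⊕₂    : ∀ {G Γ A B} → ⊢HCP ((B ∷ Γ) ∷ G) → ⊢HCP (((A ⊕ B) ∷ Γ) ∷ G)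
  &R    : ∀ {Γ A B} → ⊢HCP ((A ∷ Γ) ∷ []) → ⊢HCP ((B ∷ Γ) ∷ []) → ⊢HCP (((A & B) ∷ Γ) ∷ [])
  !R    : ∀ {Γ A} → WhyNotEnv Γ → ⊢HCP ((A ∷ Γ) ∷ []) → ⊢HCP (((`! A) ∷ Γ) ∷ [])
  ?R    : ∀ {G Γ A} → ⊢HCP ((A ∷ Γ) ∷ G) → ⊢HCP (((`? A) ∷ Γ) ∷ G)
  weak  : ∀ {G Γ A} → ⊢HCP (Γ ∷ G) → ⊢HCP (((`? A) ∷ Γ) ∷ G)
  contr : ∀ {G Γ A} → ⊢HCP (((`? A) ∷ (`? A) ∷ Γ) ∷ G) → ⊢HCP (((`? A) ∷ Γ) ∷ G)

module Submission where

-- The proof is a single structural induction on the HCP derivation, read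
-- componentwise.  Each HCP rule other than the mixes acts on one or two
-- distinguished components at the head of the hyperenvironment and leaves
-- the rest untouched, and it is the hypersequent form of a CLL rule with the
-- same premises: the one-component rules (⅋, ⊥, ⊕, ?, W, C, exchange) are
-- unary CLL rules, while H-Cut and ⊗ join two components exactly as binary
-- CLL Cut and ⊗ join two separate CLL proofs.  H-Mix and H-Mix₀ become concatenation and the empty
-- list of proofs, a hyperexchange is a permutation of the list of proofs,
-- and the rules restricted to a single component (&, !) read off the unique
-- CLL proof with 'head'.

open import Defs
open import Data.List using (List; _∷_)
open import Data.List.Relation.Unary.All using (All; []; _∷_; head)
open import Data.List.Relation.Unary.All.Properties using (++⁺)
open import Data.List.Relation.Binary.Permutation.Propositional.Properties
  using (All-resp-↭)

onHead : ∀ {a} {A : Set a} {P : A → Set} {x y : A} {xs : List A} →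
         (P x → P y) → All P (x ∷ xs) → All P (y ∷ xs)
onHead f (px ∷ pxs) = f px ∷ pxs

joinHeads : ∀ {a} {A : Set a} {P : A → Set} {x y z : A} {xs : List A} →
            (P x → P y → P z) → All P (x ∷ y ∷ xs) → All P (z ∷ xs)
joinHeads f (px ∷ py ∷ pxs) = f px py ∷ pxs

disentangle : ∀ {G : HEnv} → ⊢HCP G → All ⊢CLL G
disentangle (hexch G↭H d) = All-resp-↭ G↭H (disentangle d)
disentangle (exch Γ↭Δ d)  = onHead (exch Γ↭Δ) (disentangle d)
disentangle (ax A)        = ax A ∷ []
disentangle (hcut A d)    = joinHeads (cut A) (disentangle d)
disentangle (hmix d e)    = ++⁺ (disentangle d) (disentangle e)
disentangle hmix₀         = []
disentangle (⊗R d)        = joinHeads ⊗R (disentangle d)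
disentangle (𝟏R d)        = 𝟏R ∷ disentangle d
disentangle (⅋R d)        = onHead ⅋R (disentangle d)
disentangle (⊥R d)        = onHead ⊥R (disentangle d)
disentangle (⊕₁ d)        = onHead ⊕₁ (disentangle d)
disentangle (⊕₂ d)        = onHead ⊕₂ (disentangle d)
disentangle (&R d e)      = &R (head (disentangle d)) (head (disentangle e)) ∷ []
disentangle (!R w d)      = !R w (head (disentangle d)) ∷ []
disentangle (?R d)        = onHead ?R (disentangle d)
disentangle (weak d)      = onHead weak (disentangle d)
disentangle (contr d)     = onHead contr (disentangle d)

lemma2p6 : ∀ (G : HEnv) → ⊢HCP G → All ⊢CLL G
lemma2p6 G d = disentangle d
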